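{- For every integer $\beta>m$, $P_0(\beta)=|\Sigma_1|\cdot P(\beta-1)$.
   Context: Let $\Sigma$ be a finite totally ordered alphabet with $|\Sigma|=2^b$; each letter is identified bijectively with a $b$-bit vector and $a\oplus a'$ is the letter whose bit vector is the componentwise XOR. For equal-length words, $\oplus$ acts letterwise; equal-length words are compared lexicographically. An $m$-mer of a word is a contiguous factor of length $m$. Fix integers $1\le m<k$, a word $w=a_1\cdots a_m\in\Sigma^m$ and a key $\gamma=c_1\cdots c_m\in\Sigma^m$. $\Sigma_1=\{a\in\Sigma: a\oplus c_1>a_1\oplus c_1\}$. A word $z$ is a postmer if every $m$-mer $w'$ of $z$ satisfies $w'\oplus\gamma\ge w\oplus\gamma$. $P(\beta)$ is the number of postmers of length $\beta$, and $P_i(\beta)$ the number of postmers of length $\beta$ whose longest common prefix with $w$ has length exactly $i$. -}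

module Defs where

open import Data.Nat using (ℕ; zero; suc; _+_; _*_; _∸_; _^_; _≤ᵇ_; _<ᵇ_; _≡ᵇ_)
open import Data.Bool using (Bool; true; false; _∧_; _∨_; not; _xor_; if_then_else_)
open import Data.Fin using (Fin; toℕ)
open import Data.Vec as Vec using (Vec; zipWith)
open import Data.List using (List; []; _∷_; _++_; length; take; filterᵇ; map; concatMap; allFin)
open import Function.Bundles using (_↔_; Inverse)

-- The alphabet Σ: a finite totally ordered set of size 2^b, realised as
-- Fin (2 ^ b) with its natural order (every finite total order of that
-- size is isomorphic to it), together with an ARBITRARY bijection ι with
-- b-bit vectors, used to define ⊕.
Letter : ℕ → Set
Letter b = Fin (2 ^ b)

module Alphabet (b : ℕ) (ι : Letter b ↔ Vec Bool b) where

  Σ : Set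
  Σ = Letter b

  _⊕_ : Σ → Σ → Σ
  a ⊕ a' = Inverse.from ι (zipWith _xor_ (Inverse.to ι a) (Inverse.to ι a'))

  _<ˡ_ : Σ → Σ → Bool
  a <ˡ a' = toℕ a <ᵇ toℕ a'

  _=ˡ_ : Σ → Σ → Bool
  a =ˡ a' = toℕ a ≡ᵇ toℕ a'

  allᵇ : {A : Set} → (A → Bool) → List A → Bool
  allᵇ p [] = true
  allᵇ p (x ∷ xs) = p x ∧ allᵇ p xs

  Word : Set
  Word = List Σ

  _⊕w_ : Word → Word → Word
  (x ∷ xs) ⊕w (y ∷ ys) = (x ⊕ y) ∷ (xs ⊕w ys)
  _ ⊕w _ = []

  _≥lex_ : Word → Word → Bool
  [] ≥lex [] = true
  (x ∷ xs) ≥lex (y ∷ ys) = (y <ˡ x) ∨ ((x =ˡ y) ∧ (xs ≥lex ys))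
  _ ≥lex _ = false

  mmers : ℕ → Word → List Word
  mmers m [] = []
  mmers m (x ∷ xs) =
    (if m ≤ᵇ length (x ∷ xs) then take m (x ∷ xs) ∷ [] else []) ++ mmers m xs

  allWords : ℕ → List Word
  allWords zero = [] ∷ []
  allWords (suc n) = concatMap (λ a → map (a ∷_) (allWords n)) (allFin (2 ^ b))

  lcp : Word → Word → ℕ
  lcp (x ∷ xs) (y ∷ ys) = if x =ˡ y then suc (lcp xs ys) else zero
  lcp _ _ = zero

  module Params (m : ℕ) (w γ : Vec Σ m) where

    wL γL : Word
    wL = Vec.toList w
    γL = Vec.toList γ

    isPostmer : Word → Bool
    isPostmer z = allᵇ (λ w' → (w' ⊕w γL) ≥lex (wL ⊕w γL)) (mmers m z)

    P : ℕ → ℕ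
    P β = length (filterᵇ isPostmer (allWords β))

    Pᵢ : ℕ → ℕ → ℕ
    Pᵢ i β = length (filterᵇ (λ z → isPostmer z ∧ (lcp z wL ≡ᵇ i)) (allWords β))

    Σ₁ : List Σ
    Σ₁ with wL | γL
    ... | a₁ ∷ _ | c₁ ∷ _ = filterᵇ (λ a → (a₁ ⊕ c₁) <ˡ (a ⊕ c₁)) (allFin (2 ^ b))
    ... | _ | _ = []

{-# OPTIONS --safe #-}
module Submission where

-- Split a word of length β > m as z ∷ zs.  It has lcp 0 with w iff z ≠ a₁, and then
-- z ⊕ c₁ ≠ a₁ ⊕ c₁ (masking with c₁ is injective), so its first m-mer beats w after
-- masking iff z ⊕ c₁ > a₁ ⊕ c₁, i.e. z ∈ Σ₁; all later m-mers are those of zs.  Hence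
-- the words counted by P₀(β) are exactly Σ₁ × (postmers of length β − 1).

open import Defs
open import Data.Bool using (Bool; true; false; not; _∧_; _xor_)
open import Data.Bool.Properties
  using (T?; T-≡; ¬-not; ∧-zeroʳ; ∧-identityʳ; ∨-identityʳ; xor-assoc; xor-same; xor-identityʳ)
open import Data.Fin using (toℕ; _≟_)
open import Data.Fin.Properties using (toℕ-injective)
open import Data.List
  using (List; []; _∷_; _++_; length; take; filterᵇ; map; concatMap; cartesianProductWith; allFin)
open import Data.List.Properties using (length-++; filter-++; filter-none)
open import Data.List.Relation.Unary.All as All using (All; []; _∷_)
open import Data.List.Relation.Unary.All.Properties using (concat⁺; map⁺)
open import Data.Nat using (ℕ; zero; suc; _+_; _*_; _∸_; _^_; _≤_; _<_; _≤ᵇ_; _≡ᵇ_)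
open import Data.Nat.Properties using (≡ᵇ⇒≡; ≡⇒≡ᵇ; <ᵇ⇒<; ≤⇒≤ᵇ; <-irrefl; <⇒≤)
open import Data.Vec using (Vec; []; _∷_; zipWith; toList)
open import Function using (_∘_; const)
open import Function.Bundles using (_↔_; Inverse; Equivalence)
open import Relation.Binary.PropositionalEquality
  using (_≡_; _≢_; refl; sym; trans; cong; cong₂; subst; module ≡-Reasoning)
open import Relation.Nullary using (yes; no)

private variable
  A B C : Set

length-filterᵇ-++ : (p : A → Bool) (xs ys : List A) →
  length (filterᵇ p (xs ++ ys)) ≡ length (filterᵇ p xs) + length (filterᵇ p ys)
length-filterᵇ-++ p xs ys = trans (cong length (filter-++ (T? ∘ p) xs ys)) (length-++ (filterᵇ p xs))

filterᵇ-const-false : (xs : List A) → filterᵇ (const false) xs ≡ []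
filterᵇ-const-false xs = filter-none (T? ∘ const false) (All.universal (λ _ ()) xs)

length-filterᵇ-map : {p : B → Bool} {q : A → Bool} {h : A → B} {ys : List A} →
  All (λ y → p (h y) ≡ q y) ys → length (filterᵇ p (map h ys)) ≡ length (filterᵇ q ys)
length-filterᵇ-map [] = refl
length-filterᵇ-map {q = q} {ys = y ∷ _} (eq ∷ eqs) rewrite eq with q y
... | true  = cong suc (length-filterᵇ-map eqs)
... | false = length-filterᵇ-map eqs

cartesianProductWith-concatMap : (h : A → B → C) (xs : List A) (ys : List B) →
  concatMap (λ x → map (h x) ys) xs ≡ cartesianProductWith h xs ys
cartesianProductWith-concatMap h []       ys = refl
cartesianProductWith-concatMap h (x ∷ xs) ys =
  cong (map (h x) ys ++_) (cartesianProductWith-concatMap h xs ys)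

length-filterᵇ-cartesianProductWith :
  (p : C → Bool) (f : A → Bool) (g : B → Bool) (h : A → B → C) (xs : List A) {ys : List B} →
  (∀ x → All (λ y → p (h x y) ≡ f x ∧ g y) ys) →
  length (filterᵇ p (cartesianProductWith h xs ys)) ≡ length (filterᵇ f xs) * length (filterᵇ g ys)
length-filterᵇ-cartesianProductWith p f g h [] eqs = refl
length-filterᵇ-cartesianProductWith p f g h (x ∷ xs) {ys} eqs
  rewrite length-filterᵇ-++ p (map (h x) ys) (cartesianProductWith h xs ys)
        | length-filterᵇ-cartesianProductWith p f g h xs eqs
  with f x | eqs x
... | true  | eqsₓ = cong (_+ _) (length-filterᵇ-map eqsₓ)
... | false | eqsₓ =
  cong (_+ _) (trans (length-filterᵇ-map eqsₓ) (cong length (filterᵇ-const-false ys)))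

xor-cancelʳ : ∀ x y → (x xor y) xor y ≡ x
xor-cancelʳ x y = trans (xor-assoc x y y) (trans (cong (x xor_) (xor-same y)) (xor-identityʳ x))

zipWith-xor-cancelʳ : ∀ {n} (u v : Vec Bool n) → zipWith _xor_ (zipWith _xor_ u v) v ≡ u
zipWith-xor-cancelʳ []      []      = refl
zipWith-xor-cancelʳ (x ∷ u) (y ∷ v) = cong₂ _∷_ (xor-cancelʳ x y) (zipWith-xor-cancelʳ u v)

module _ (b : ℕ) (ι : Letter b ↔ Vec Bool b) where
  open Alphabet b ι
  open Inverse ι

  ⊕-cancelʳ : ∀ {a a'} c → a ⊕ c ≡ a' ⊕ c → a ≡ a'
  ⊕-cancelʳ {a} {a'} c eq = begin
    a                       ≡⟨ strictlyInverseʳ a ⟨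
    from (to a)             ≡⟨ cong from (unmask-⊕ a) ⟨
    from (unmask (a ⊕ c))   ≡⟨ cong (from ∘ unmask) eq ⟩
    from (unmask (a' ⊕ c))  ≡⟨ cong from (unmask-⊕ a') ⟩
    from (to a')            ≡⟨ strictlyInverseʳ a' ⟩
    a'                      ∎
    where
    open ≡-Reasoning
    unmask : Σ → Vec Bool b
    unmask d = zipWith _xor_ (to d) (to c)
    unmask-⊕ : ∀ d → unmask (d ⊕ c) ≡ to d
    unmask-⊕ d = trans (cong (λ u → zipWith _xor_ u (to c)) (strictlyInverseˡ _))
                       (zipWith-xor-cancelʳ (to d) (to c))

  =ˡ-refl : ∀ a → (a =ˡ a) ≡ true
  =ˡ-refl a = Equivalence.to T-≡ (≡⇒≡ᵇ (toℕ a) (toℕ a) refl)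

  =ˡ-≢ : ∀ {a a'} → a ≢ a' → (a =ˡ a') ≡ false
  =ˡ-≢ {a} {a'} a≢a' = ¬-not (a≢a' ∘ toℕ-injective ∘ ≡ᵇ⇒≡ (toℕ a) (toℕ a') ∘ Equivalence.from T-≡)

  <ˡ-irrefl : ∀ a → (a <ˡ a) ≡ false
  <ˡ-irrefl a = ¬-not (<-irrefl refl ∘ <ᵇ⇒< (toℕ a) (toℕ a) ∘ Equivalence.from T-≡)

  ≥lex-∷-≢ : ∀ {x y} (xs ys : Word) → x ≢ y → ((x ∷ xs) ≥lex (y ∷ ys)) ≡ (y <ˡ x)
  ≥lex-∷-≢ xs ys x≢y rewrite =ˡ-≢ x≢y = ∨-identityʳ _

  lcp-∷-≡ᵇ-0 : ∀ x y (xs ys : Word) → (lcp (x ∷ xs) (y ∷ ys) ≡ᵇ 0) ≡ not (x =ˡ y)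
  lcp-∷-≡ᵇ-0 x y xs ys with x =ˡ y
  ... | true  = refl
  ... | false = refl

  allWords-length : ∀ n → All (λ z → length z ≡ n) (allWords n)
  allWords-length zero    = refl ∷ []
  allWords-length (suc n) =
    concat⁺ (map⁺ (All.universal (λ _ → map⁺ (All.map (cong suc) (allWords-length n))) (allFin (2 ^ b))))

  allWords-suc : ∀ n → allWords (suc n) ≡ cartesianProductWith _∷_ (allFin (2 ^ b)) (allWords n)
  allWords-suc n = cartesianProductWith-concatMap _∷_ (allFin (2 ^ b)) (allWords n)

  module _ (m : ℕ) (w γ : Vec Σ m) where
    open Params m w γ

    isPostmer-∷ : ∀ z zs → m ≤ suc (length zs) →
      isPostmer (z ∷ zs) ≡ ((take m (z ∷ zs) ⊕w γL) ≥lex (wL ⊕w γL)) ∧ isPostmer zs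
    isPostmer-∷ z zs m≤ with m ≤ᵇ suc (length zs) | ≤⇒≤ᵇ m≤
    ... | true | _ = refl

  module _ {m : ℕ} (a₁ c₁ : Σ) (w γ : Vec Σ m) where
    open Params (suc m) (a₁ ∷ w) (c₁ ∷ γ)

    isPostmer∧lcp≡ᵇ0-∷ : ∀ z zs → suc m ≤ suc (length zs) →
      (isPostmer (z ∷ zs) ∧ (lcp (z ∷ zs) wL ≡ᵇ 0)) ≡ (((a₁ ⊕ c₁) <ˡ (z ⊕ c₁)) ∧ isPostmer zs)
    isPostmer∧lcp≡ᵇ0-∷ z zs m≤ with z ≟ a₁
    ... | yes refl = begin
      isPostmer (z ∷ zs) ∧ (lcp (z ∷ zs) wL ≡ᵇ 0)
        ≡⟨ cong (isPostmer (z ∷ zs) ∧_) (trans (lcp-∷-≡ᵇ-0 z z zs _) (cong not (=ˡ-refl z))) ⟩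
      isPostmer (z ∷ zs) ∧ false
        ≡⟨ ∧-zeroʳ _ ⟩
      false
        ≡⟨ cong (_∧ isPostmer zs) (<ˡ-irrefl (z ⊕ c₁)) ⟨
      ((z ⊕ c₁) <ˡ (z ⊕ c₁)) ∧ isPostmer zs
        ∎
      where open ≡-Reasoning
    ... | no z≢a₁ = begin
      isPostmer (z ∷ zs) ∧ (lcp (z ∷ zs) wL ≡ᵇ 0)
        ≡⟨ cong₂ _∧_ (isPostmer-∷ (suc m) (a₁ ∷ w) (c₁ ∷ γ) z zs m≤)
                     (trans (lcp-∷-≡ᵇ-0 z a₁ zs _) (cong not (=ˡ-≢ z≢a₁))) ⟩
      (((z ⊕ c₁) ∷ zs⊕γ) ≥lex ((a₁ ⊕ c₁) ∷ w⊕γ) ∧ isPostmer zs) ∧ true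
        ≡⟨ ∧-identityʳ _ ⟩
      ((z ⊕ c₁) ∷ zs⊕γ) ≥lex ((a₁ ⊕ c₁) ∷ w⊕γ) ∧ isPostmer zs
        ≡⟨ cong (_∧ isPostmer zs) (≥lex-∷-≢ zs⊕γ w⊕γ (z≢a₁ ∘ ⊕-cancelʳ c₁)) ⟩
      ((a₁ ⊕ c₁) <ˡ (z ⊕ c₁)) ∧ isPostmer zs
        ∎
      where
      open ≡-Reasoning
      zs⊕γ w⊕γ : Word
      zs⊕γ = take m zs ⊕w toList γ
      w⊕γ  = toList w ⊕w toList γ

lemma7 : (b : ℕ) (ι : Letter b ↔ Vec Bool b) (m k : ℕ) → 1 ≤ m → m < k →
         (w γ : Vec (Letter b) m) (β : ℕ) → m < β →
         Alphabet.Params.Pᵢ b ι m w γ 0 β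
           ≡ length (Alphabet.Params.Σ₁ b ι m w γ) * Alphabet.Params.P b ι m w γ (β ∸ 1)
lemma7 b ι zero    k () _ _ _ _ _
lemma7 b ι (suc m) k _ _ (a₁ ∷ w) (c₁ ∷ γ) zero ()
lemma7 b ι (suc m) k _ _ (a₁ ∷ w) (c₁ ∷ γ) (suc n) m<β = begin
  Pᵢ 0 (suc n)
    ≡⟨ cong (length ∘ filterᵇ _) (allWords-suc b ι n) ⟩
  length (filterᵇ _ (cartesianProductWith _∷_ (allFin (2 ^ b)) (allWords n)))
    ≡⟨ length-filterᵇ-cartesianProductWith _ _ _ _∷_ (allFin (2 ^ b))
         (λ z → All.map (split-first-letter z) (allWords-length b ι n)) ⟩
  length Σ₁ * P n ∎
  where
  open Alphabet b ι
  open Params (suc m) (a₁ ∷ w) (c₁ ∷ γ)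
  open ≡-Reasoning
  split-first-letter : ∀ z {zs} → length zs ≡ n →
    (isPostmer (z ∷ zs) ∧ (lcp (z ∷ zs) wL ≡ᵇ 0)) ≡ (((a₁ ⊕ c₁) <ˡ (z ⊕ c₁)) ∧ isPostmer zs)
  split-first-letter z {zs} len≡n =
    isPostmer∧lcp≡ᵇ0-∷ b ι a₁ c₁ w γ z zs (subst (λ l → suc m ≤ suc l) (sym len≡n) (<⇒≤ m<β))
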